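{- Let $F\colon\mathcal{C}\to\mathcal{D}$ be a lax gs-monoidal functor between gs-monoidal categories. Then for every morphism $g\colon A\to X$ in $\mathcal{C}$, $F(\mathrm{dom}(g))=\mathrm{dom}(F(g))$.
   Context: A gs-monoidal category is a symmetric monoidal category (tensor $\otimes$, unit $I$) whose objects carry commutative comonoids $\mathrm{copy}_A\colon A\to A\otimes A$, $\mathrm{del}_A\colon A\to I$ compatible with $\otimes$ ($\mathrm{copy}_{A\otimes X}=(\mathrm{id}\otimes\mathrm{swap}\otimes\mathrm{id})\circ(\mathrm{copy}_A\otimes\mathrm{copy}_X)$, $\mathrm{del}_{A\otimes X}=\mathrm{del}_A\otimes\mathrm{del}_X$), with $\mathrm{del}_I=\mathrm{id}_I$. The domain of $f\colon A\to X$ is $\mathrm{dom}(f):=\rho_A\circ(\mathrm{id}_A\otimes(\mathrm{del}_X\circ f))\circ\mathrm{copy}_A\colon A\to A$, with $\rho$ the right unitor. A lax gs-monoidal functor $F\colon\mathcal{C}\to\mathcal{D}$ is a lax symmetric monoidal functor, with structure morphisms $\psi_0\colon I_\mathcal{D}\to F(I_\mathcal{C})$ and natural $\psi_{A,B}\colon F(A)\otimes F(B)\to F(A\otimes B)$ satisfying the usual associativity, unit and symmetry coherence conditions, such that $F(\mathrm{copy}_A)=\psi_{A,A}\circ\mathrm{copy}_{F(A)}$ and $F(\mathrm{del}_A)=\psi_0\circ\mathrm{del}_{F(A)}$ for all objects $A$. -}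

module Defs where

open import Level using (Level; _⊔_) renaming (suc to lsuc)
open import Relation.Binary using (Rel; IsEquivalence)

record Category (o ℓ e : Level) : Set (lsuc (o ⊔ ℓ ⊔ e)) where
  infix  4 _≈_
  infixr 9 _∘_
  field
    Obj  : Set o
    _⇒_  : Obj → Obj → Set ℓ
    _≈_  : ∀ {A B} → Rel (A ⇒ B) e
    id   : ∀ {A} → A ⇒ A
    _∘_  : ∀ {A B C} → B ⇒ C → A ⇒ B → A ⇒ C
    equiv     : ∀ {A B} → IsEquivalence (_≈_ {A} {B})
    ∘-resp-≈  : ∀ {A B C} {f h : B ⇒ C} {g i : A ⇒ B} → f ≈ h → g ≈ i → f ∘ g ≈ h ∘ i
    assoc     : ∀ {A B C D} {f : A ⇒ B} {g : B ⇒ C} {h : C ⇒ D} → (h ∘ g) ∘ f ≈ h ∘ (g ∘ f)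
    identityˡ : ∀ {A B} {f : A ⇒ B} → id ∘ f ≈ f
    identityʳ : ∀ {A B} {f : A ⇒ B} → f ∘ id ≈ f

record SymmetricMonoidal {o ℓ e} (C : Category o ℓ e) : Set (o ⊔ ℓ ⊔ e) where
  open Category C
  infixr 10 _⊗₀_ _⊗₁_
  field
    _⊗₀_ : Obj → Obj → Obj
    _⊗₁_ : ∀ {A B X Y} → A ⇒ B → X ⇒ Y → (A ⊗₀ X) ⇒ (B ⊗₀ Y)
    ⊗-identity : ∀ {A X} → (id {A} ⊗₁ id {X}) ≈ id
    ⊗-homomorphism : ∀ {A B C X Y Z} {f : A ⇒ B} {g : B ⇒ C} {h : X ⇒ Y} {k : Y ⇒ Z} →
                     ((g ∘ f) ⊗₁ (k ∘ h)) ≈ (g ⊗₁ k) ∘ (f ⊗₁ h)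
    ⊗-resp-≈ : ∀ {A B X Y} {f g : A ⇒ B} {h k : X ⇒ Y} → f ≈ g → h ≈ k → (f ⊗₁ h) ≈ (g ⊗₁ k)
    unit : Obj
    α⇒ : ∀ {A B C} → ((A ⊗₀ B) ⊗₀ C) ⇒ (A ⊗₀ (B ⊗₀ C))
    α⇐ : ∀ {A B C} → (A ⊗₀ (B ⊗₀ C)) ⇒ ((A ⊗₀ B) ⊗₀ C)
    α-isoˡ : ∀ {A B C} → α⇐ {A} {B} {C} ∘ α⇒ ≈ id
    α-isoʳ : ∀ {A B C} → α⇒ {A} {B} {C} ∘ α⇐ ≈ id
    α-natural : ∀ {A B C X Y Z} {f : A ⇒ X} {g : B ⇒ Y} {h : C ⇒ Z} →
                α⇒ ∘ ((f ⊗₁ g) ⊗₁ h) ≈ (f ⊗₁ (g ⊗₁ h)) ∘ α⇒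
    λ⇒ : ∀ {A} → (unit ⊗₀ A) ⇒ A
    λ⇐ : ∀ {A} → A ⇒ (unit ⊗₀ A)
    λ-isoˡ : ∀ {A} → λ⇐ {A} ∘ λ⇒ ≈ id
    λ-isoʳ : ∀ {A} → λ⇒ {A} ∘ λ⇐ ≈ id
    λ-natural : ∀ {A B} {f : A ⇒ B} → λ⇒ ∘ (id ⊗₁ f) ≈ f ∘ λ⇒
    ρ⇒ : ∀ {A} → (A ⊗₀ unit) ⇒ A
    ρ⇐ : ∀ {A} → A ⇒ (A ⊗₀ unit)
    ρ-isoˡ : ∀ {A} → ρ⇐ {A} ∘ ρ⇒ ≈ id
    ρ-isoʳ : ∀ {A} → ρ⇒ {A} ∘ ρ⇐ ≈ id
    ρ-natural : ∀ {A B} {f : A ⇒ B} → ρ⇒ ∘ (f ⊗₁ id) ≈ f ∘ ρ⇒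
    triangle : ∀ {A B} → (id {A} ⊗₁ λ⇒ {B}) ∘ α⇒ ≈ ρ⇒ ⊗₁ id
    pentagon : ∀ {A B C D} →
               (id {A} ⊗₁ α⇒ {B} {C} {D}) ∘ α⇒ ∘ (α⇒ ⊗₁ id) ≈ α⇒ ∘ α⇒
    σ : ∀ {A B} → (A ⊗₀ B) ⇒ (B ⊗₀ A)
    σ-natural : ∀ {A B X Y} {f : A ⇒ X} {g : B ⇒ Y} → σ ∘ (f ⊗₁ g) ≈ (g ⊗₁ f) ∘ σ
    σ-involutive : ∀ {A B} → σ {B} {A} ∘ σ {A} {B} ≈ id
    hexagon : ∀ {A B C} →
              (id {B} ⊗₁ σ {A} {C}) ∘ α⇒ ∘ (σ ⊗₁ id) ≈ α⇒ ∘ σ ∘ α⇒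

record GSMonoidalCategory (o ℓ e : Level) : Set (lsuc (o ⊔ ℓ ⊔ e)) where
  field
    cat : Category o ℓ e
    sym : SymmetricMonoidal cat
  open Category cat public
  open SymmetricMonoidal sym public

  -- middle-four interchange (A⊗A)⊗(X⊗X) → (A⊗X)⊗(A⊗X), i.e. id⊗swap⊗id
  interchange : ∀ {A B X Y} → ((A ⊗₀ B) ⊗₀ (X ⊗₀ Y)) ⇒ ((A ⊗₀ X) ⊗₀ (B ⊗₀ Y))
  interchange = α⇐ ∘ (id ⊗₁ (α⇒ ∘ (σ ⊗₁ id) ∘ α⇐)) ∘ α⇒

  field
    copy : ∀ A → A ⇒ (A ⊗₀ A)
    del  : ∀ A → A ⇒ unit
    copy-assoc : ∀ {A} → α⇒ ∘ (copy A ⊗₁ id) ∘ copy A ≈ (id ⊗₁ copy A) ∘ copy A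
    copy-unitˡ : ∀ {A} → λ⇒ ∘ (del A ⊗₁ id) ∘ copy A ≈ id
    copy-unitʳ : ∀ {A} → ρ⇒ ∘ (id ⊗₁ del A) ∘ copy A ≈ id
    copy-comm  : ∀ {A} → σ ∘ copy A ≈ copy A
    copy-⊗ : ∀ {A X} → copy (A ⊗₀ X) ≈ interchange ∘ (copy A ⊗₁ copy X)
    del-⊗  : ∀ {A X} → del (A ⊗₀ X) ≈ λ⇒ ∘ (del A ⊗₁ del X)
    del-unit : del unit ≈ id

  dom : ∀ {A X} → A ⇒ X → A ⇒ A
  dom {A} {X} f = ρ⇒ ∘ (id ⊗₁ (del X ∘ f)) ∘ copy A

record LaxGSFunctor {o ℓ e o′ ℓ′ e′}
                    (C : GSMonoidalCategory o ℓ e) (D : GSMonoidalCategory o′ ℓ′ e′)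
                    : Set (o ⊔ ℓ ⊔ e ⊔ o′ ⊔ ℓ′ ⊔ e′) where
  private
    module C = GSMonoidalCategory C
    module D = GSMonoidalCategory D
  field
    F₀ : C.Obj → D.Obj
    F₁ : ∀ {A B} → A C.⇒ B → F₀ A D.⇒ F₀ B
    F-identity : ∀ {A} → F₁ (C.id {A}) D.≈ D.id
    F-homomorphism : ∀ {A B Z} {f : A C.⇒ B} {g : B C.⇒ Z} →
                     F₁ (g C.∘ f) D.≈ F₁ g D.∘ F₁ f
    F-resp-≈ : ∀ {A B} {f g : A C.⇒ B} → f C.≈ g → F₁ f D.≈ F₁ g
    ψ₀ : D.unit D.⇒ F₀ C.unit
    ψ  : ∀ {A B} → (F₀ A D.⊗₀ F₀ B) D.⇒ F₀ (A C.⊗₀ B)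
    ψ-natural : ∀ {A B X Y} {f : A C.⇒ X} {g : B C.⇒ Y} →
                ψ D.∘ (F₁ f D.⊗₁ F₁ g) D.≈ F₁ (f C.⊗₁ g) D.∘ ψ
    ψ-assoc : ∀ {A B Z} →
              F₁ (C.α⇒ {A} {B} {Z}) D.∘ ψ D.∘ (ψ D.⊗₁ D.id)
                D.≈ ψ D.∘ (D.id D.⊗₁ ψ) D.∘ D.α⇒
    ψ-unitˡ : ∀ {A} → F₁ (C.λ⇒ {A}) D.∘ ψ D.∘ (ψ₀ D.⊗₁ D.id) D.≈ D.λ⇒
    ψ-unitʳ : ∀ {A} → F₁ (C.ρ⇒ {A}) D.∘ ψ D.∘ (D.id D.⊗₁ ψ₀) D.≈ D.ρ⇒
    ψ-sym : ∀ {A B} → F₁ (C.σ {A} {B}) D.∘ ψ D.≈ ψ D.∘ D.σ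
    F-copy : ∀ {A} → F₁ (C.copy A) D.≈ ψ D.∘ D.copy (F₀ A)
    F-del  : ∀ {A} → F₁ (C.del A) D.≈ ψ₀ D.∘ D.del (F₀ A)

-- F ρ ∘ ψ ∘ (id ⊗ ψ₀) = ρ is the right-unit coherence of a lax monoidal functor.
-- Pushing F through dom g, F-copy produces a ψ, naturality of ψ moves it past
-- id ⊗ (del ∘ g), and F-del produces the ψ₀ that completes that coherence cell.
module Submission where

open import Defs
open import Level using (Level)
open import Relation.Binary using (Setoid)
import Relation.Binary.Reasoning.Setoid as SetoidReasoning

module HomReasoning {o ℓ e} (C : Category o ℓ e) where
  open Category C

  hom-setoid : ∀ A B → Setoid ℓ e
  hom-setoid A B = record { Carrier = A ⇒ B ; _≈_ = _≈_ ; isEquivalence = equiv }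

  module _ {A B : Obj} where
    open Setoid (hom-setoid A B) public using () renaming (refl to ≈-refl; sym to ≈-sym; trans to ≈-trans)
    open SetoidReasoning (hom-setoid A B) public

  infixr 4 _⟩∘⟨_ refl⟩∘⟨_
  infixl 5 _⟩∘⟨refl

  _⟩∘⟨_ : ∀ {A B C} {f h : B ⇒ C} {g i : A ⇒ B} → f ≈ h → g ≈ i → f ∘ g ≈ h ∘ i
  _⟩∘⟨_ = ∘-resp-≈

  refl⟩∘⟨_ : ∀ {A B C} {f : B ⇒ C} {g i : A ⇒ B} → g ≈ i → f ∘ g ≈ f ∘ i
  refl⟩∘⟨ g≈i = ≈-refl ⟩∘⟨ g≈i

  _⟩∘⟨refl : ∀ {A B C} {f h : B ⇒ C} {g : A ⇒ B} → f ≈ h → f ∘ g ≈ h ∘ g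
  f≈h ⟩∘⟨refl = f≈h ⟩∘⟨ ≈-refl

  pullˡ : ∀ {A B C D} {f : A ⇒ B} {g : B ⇒ C} {h : C ⇒ D} {k : B ⇒ D} →
          h ∘ g ≈ k → h ∘ (g ∘ f) ≈ k ∘ f
  pullˡ hg≈k = ≈-trans (≈-sym assoc) (hg≈k ⟩∘⟨refl)

module MonoidalProperties {o ℓ e} {C : Category o ℓ e} (M : SymmetricMonoidal C) where
  open Category C
  open SymmetricMonoidal M
  open HomReasoning C

  id⊗-∘ : ∀ {A X Y Z} {f : X ⇒ Y} {g : Y ⇒ Z} →
          id {A} ⊗₁ (g ∘ f) ≈ (id ⊗₁ g) ∘ (id ⊗₁ f)
  id⊗-∘ = ≈-trans (⊗-resp-≈ (≈-sym identityˡ) ≈-refl) ⊗-homomorphism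

module LaxGSFunctorProperties {o ℓ e o′ ℓ′ e′}
  {C : GSMonoidalCategory o ℓ e} {D : GSMonoidalCategory o′ ℓ′ e′} (F : LaxGSFunctor C D) where
  private
    module C = GSMonoidalCategory C
  open GSMonoidalCategory D
  open HomReasoning cat
  open MonoidalProperties sym
  open LaxGSFunctor F

  ψ-natural-idˡ : ∀ {A X Y} {f : X C.⇒ Y} →
                  F₁ (C.id {A} C.⊗₁ f) ∘ ψ ≈ ψ ∘ (id ⊗₁ F₁ f)
  ψ-natural-idˡ = ≈-trans (≈-sym ψ-natural) (refl⟩∘⟨ ⊗-resp-≈ F-identity ≈-refl)

  F-del-∘ : ∀ {A X} {g : A C.⇒ X} → F₁ (C.del X C.∘ g) ≈ ψ₀ ∘ del (F₀ X) ∘ F₁ g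
  F-del-∘ = ≈-trans F-homomorphism (≈-trans (F-del ⟩∘⟨refl) assoc)

  ψ-unitʳ-∘ : ∀ {A B} {k : B ⇒ unit} →
              F₁ (C.ρ⇒ {A}) ∘ ψ ∘ (id ⊗₁ (ψ₀ ∘ k)) ≈ ρ⇒ ∘ (id ⊗₁ k)
  ψ-unitʳ-∘ {k = k} = begin
    F₁ C.ρ⇒ ∘ ψ ∘ (id ⊗₁ (ψ₀ ∘ k))          ≈⟨ refl⟩∘⟨ refl⟩∘⟨ id⊗-∘ ⟩
    F₁ C.ρ⇒ ∘ ψ ∘ (id ⊗₁ ψ₀) ∘ (id ⊗₁ k)    ≈⟨ refl⟩∘⟨ ≈-sym assoc ⟩
    F₁ C.ρ⇒ ∘ (ψ ∘ (id ⊗₁ ψ₀)) ∘ (id ⊗₁ k)  ≈⟨ pullˡ ψ-unitʳ ⟩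
    ρ⇒ ∘ (id ⊗₁ k)                          ∎

  F-dom : ∀ {A X} (g : A C.⇒ X) → F₁ (C.dom g) ≈ dom (F₁ g)
  F-dom {A} {X} g = begin
    F₁ (C.ρ⇒ C.∘ (C.id C.⊗₁ (C.del X C.∘ g)) C.∘ C.copy A)
      ≈⟨ ≈-trans F-homomorphism (refl⟩∘⟨ F-homomorphism) ⟩
    F₁ C.ρ⇒ ∘ F₁ (C.id C.⊗₁ (C.del X C.∘ g)) ∘ F₁ (C.copy A)
      ≈⟨ refl⟩∘⟨ refl⟩∘⟨ F-copy ⟩
    F₁ C.ρ⇒ ∘ F₁ (C.id C.⊗₁ (C.del X C.∘ g)) ∘ ψ ∘ copy (F₀ A)
      ≈⟨ refl⟩∘⟨ pullˡ ψ-natural-idˡ ⟩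
    F₁ C.ρ⇒ ∘ (ψ ∘ (id ⊗₁ F₁ (C.del X C.∘ g))) ∘ copy (F₀ A)
      ≈⟨ refl⟩∘⟨ (refl⟩∘⟨ ⊗-resp-≈ ≈-refl F-del-∘) ⟩∘⟨refl ⟩
    F₁ C.ρ⇒ ∘ (ψ ∘ (id ⊗₁ (ψ₀ ∘ del (F₀ X) ∘ F₁ g))) ∘ copy (F₀ A)
      ≈⟨ pullˡ ψ-unitʳ-∘ ⟩
    (ρ⇒ ∘ (id ⊗₁ (del (F₀ X) ∘ F₁ g))) ∘ copy (F₀ A)
      ≈⟨ assoc ⟩
    ρ⇒ ∘ (id ⊗₁ (del (F₀ X) ∘ F₁ g)) ∘ copy (F₀ A)
      ∎

mainTheorem18 : ∀ {o ℓ e o′ ℓ′ e′ : Level} (C : GSMonoidalCategory o ℓ e) (D : GSMonoidalCategory o′ ℓ′ e′) (F : LaxGSFunctor C D) → ∀ {A X} (g : GSMonoidalCategory._⇒_ C A X) → GSMonoidalCategory._≈_ D (LaxGSFunctor.F₁ F (GSMonoidalCategory.dom C g)) (GSMonoidalCategory.dom D (LaxGSFunctor.F₁ F g))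
mainTheorem18 C D F = LaxGSFunctorProperties.F-dom F
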